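{- If $\Gamma\vdash M$ is derivable and $M$ is constructed from variables and blocks of the form $(\pi_{a_1\ldots a_mb})\circ b$ ($m\geqslant0$) by application and abstraction, then either $M$ is pure (contains no blocks) or one of the rules $\alpha_1$, $\alpha_2$ can be applied to $\Gamma\vdash M$.
   Context: Calculus $\lambda\pi$: terms $M,N::= a\mid MN\mid\lambda a.M\mid s\circ M$, substitutions $s,q::= id\mid\pi_a\mid\langle s\,,\,N\backslash a\rangle\mid s\circ q$; $\pi_{a_1\ldots a_n}$ denotes $(\ldots((\pi_{a_1}\circ\pi_{a_2})\circ\ldots)\circ\pi_{a_n}$; a term is pure if it contains no sub-term $s\circ N$. Derivable judgements (contexts = lists of variables with repetitions): $\Gamma,a\vdash a$; $\Gamma\vdash a\Rightarrow\Gamma,b\vdash a$ ($a\neq b$); application; $\Gamma,a\vdash M\Rightarrow\Gamma\vdash\lambda a.M$; $\Gamma\vdash s\triangleright\Delta,\Delta\vdash M\Rightarrow\Gamma\vdash s\circ M$; $\Gamma\vdash id\triangleright\Gamma$; $\Gamma,a\vdash\pi_a\triangleright\Gamma$; $\Gamma\vdash s\triangleright\Delta,\Gamma\vdash N\Rightarrow\Gamma\vdash\langle s\,,\,N\backslash a\rangle\triangleright\Delta,a$; $\Gamma\vdash s\triangleright\Delta,\Delta\vdash q\triangleright\Sigma\Rightarrow\Gamma\vdash s\circ q\triangleright\Sigma$. Free variables: $FV(M)=\langle FV_1(M),FV_2(M),\ldots\rangle$ with $FV(a)=\langle\{a\},\emptyset,\ldots\rangle$, $FV(MN)=FV(M)\cup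 FV(N)$, $FV(\lambda a.M)=O_{\lambda a}(FV(M))$, $FV(s\circ M)=O_s(FV(M))$, where $O_{\lambda a}(\mathcal A)=\langle(\mathcal A_1\setminus\{a\})\cup\mathcal A_2,\mathcal A_3,\ldots\rangle$, $O_{id}=$ identity, $O_{\pi_a}(\mathcal A)=\langle\emptyset,\mathcal A_1,\mathcal A_2,\ldots\rangle$, $O_{s\circ q}=O_s\circ O_q$, $O_{\langle s,N\backslash a\rangle}(\mathcal A)=O_s(O_{\lambda a}(\mathcal A))\cup FV(N)$; $FV(\Gamma\vdash M)=FV(\lambda\Gamma.M)$ ($\lambda\,nil.M=M$, $\lambda\Sigma,a.M=\lambda\Sigma.\lambda a.M$). Rules: ($\alpha_1$) $\lambda a.M\rightarrow\lambda b.\langle\pi_b\,,\,b\backslash a\rangle\circ M$ (inside any term) if $a\in\bigcup_iFV_i(\lambda a.M)$ and $b\notin\bigcup_iFV_i(\lambda a.M)$; ($\alpha_2$) $\Gamma,a,\Delta\vdash M\rightsquigarrow\Gamma,b,\Delta\vdash\Uparrow_\Delta\langle\pi_b\,,\,b\backslash a\rangle\circ M$ if $a\in\bigcup_iFV_i(a,\Delta\vdash M)$ and $b\notin\bigcup_iFV_i(a,\Delta\vdash M)$, where $\Uparrow_{nil}(s)=s$, $\Uparrow_{\Sigma,a}(s)=\langle\pi_a\circ\Uparrow_\Sigma(s)\,,\,a\backslash a\rangle$. -}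

module Defs where

open import Data.Nat using (ℕ; zero; suc)
open import Data.List using (List; []; _∷_; foldl; _++_; [_])
open import Data.Product using (Σ; _×_; ∃; ∃-syntax; _,_)
open import Data.Sum using (_⊎_)
open import Data.Empty using (⊥)
open import Relation.Nullary using (¬_)
open import Relation.Binary.PropositionalEquality using (_≡_; _≢_)

Var : Set
Var = ℕ

infixl 7 _·_
mutual
  data Term : Set where
    var  : Var → Term
    _·_  : Term → Term → Term
    lam  : Var → Term → Term
    _∘ₜ_ : Subst → Term → Term

  data Subst : Set where
    idₛ  : Subst
    π    : Var → Subst
    ⟨_,_∖_⟩ : Subst → Term → Var → Subst
    _∘ₛ_ : Subst → Subst → Subst

infixl 5 _▸_
data Ctx : Set where
  ε   : Ctx
  _▸_ : Ctx → Var → Ctx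

infixl 4 _⧺_
_⧺_ : Ctx → Ctx → Ctx
Γ ⧺ ε       = Γ
Γ ⧺ (Δ ▸ a) = (Γ ⧺ Δ) ▸ a

infix 3 _⊢_ _⊢_▷_
mutual
  data _⊢_ : Ctx → Term → Set where
    ax   : ∀ {Γ a} → (Γ ▸ a) ⊢ var a
    weak : ∀ {Γ a b} → Γ ⊢ var a → a ≢ b → (Γ ▸ b) ⊢ var a
    app  : ∀ {Γ M N} → Γ ⊢ M → Γ ⊢ N → Γ ⊢ M · N
    abs  : ∀ {Γ a M} → (Γ ▸ a) ⊢ M → Γ ⊢ lam a M
    clos : ∀ {Γ Δ s M} → Γ ⊢ s ▷ Δ → Δ ⊢ M → Γ ⊢ s ∘ₜ M

  data _⊢_▷_ : Ctx → Subst → Ctx → Set where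
    idR   : ∀ {Γ} → Γ ⊢ idₛ ▷ Γ
    πR    : ∀ {Γ a} → (Γ ▸ a) ⊢ π a ▷ Γ
    consR : ∀ {Γ Δ s N a} → Γ ⊢ s ▷ Δ → Γ ⊢ N → Γ ⊢ ⟨ s , N ∖ a ⟩ ▷ (Δ ▸ a)
    compR : ∀ {Γ Δ Σ' s q} → Γ ⊢ s ▷ Δ → Δ ⊢ q ▷ Σ' → Γ ⊢ s ∘ₛ q ▷ Σ'

-- A sequence of sets of variables A = ⟨A₁, A₂, …⟩, indexed from 0
-- (index 0 is A₁), each set given by its membership predicate.
Family : Set₁
Family = ℕ → Var → Set

∅F : Family
∅F _ _ = ⊥

_∪F_ : Family → Family → Family
(A ∪F B) i x = A i x ⊎ B i x

Oλ : Var → Family → Family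
Oλ a A zero    x = (A 0 x × x ≢ a) ⊎ A 1 x
Oλ a A (suc k) x = A (suc (suc k)) x

Oπ : Family → Family
Oπ A zero    x = ⊥
Oπ A (suc k) x = A k x

mutual
  FV : Term → Family
  FV (var a)  zero    x = x ≡ a
  FV (var a)  (suc k) x = ⊥
  FV (M · N)          = FV M ∪F FV N
  FV (lam a M)        = Oλ a (FV M)
  FV (s ∘ₜ M)         = O s (FV M)

  O : Subst → Family → Family
  O idₛ A            = A
  O (π a) A          = Oπ A
  O ⟨ s , N ∖ a ⟩ A  = O s (Oλ a A) ∪F FV N
  O (s ∘ₛ q) A       = O s (O q A)

_∈⋃FV_ : Var → Term → Set
x ∈⋃FV M = ∃[ i ] FV M i x

lamCtx : Ctx → Term → Term
lamCtx ε       M = M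
lamCtx (Σ' ▸ a) M = lamCtx Σ' (lam a M)

_∈⋃FVj_⊢_ : Var → Ctx → Term → Set
x ∈⋃FVj Γ ⊢ M = x ∈⋃FV lamCtx Γ M

infix 2 _⟶α₁_ _⟶α₁ˢ_
mutual
  data _⟶α₁_ : Term → Term → Set where
    α₁    : ∀ {a b M} → a ∈⋃FV lam a M → ¬ (b ∈⋃FV lam a M) →
            lam a M ⟶α₁ lam b (⟨ π b , var b ∖ a ⟩ ∘ₜ M)
    appL  : ∀ {M M' N} → M ⟶α₁ M' → M · N ⟶α₁ M' · N
    appR  : ∀ {M N N'} → N ⟶α₁ N' → M · N ⟶α₁ M · N'
    lamC  : ∀ {a M M'} → M ⟶α₁ M' → lam a M ⟶α₁ lam a M'
    closL : ∀ {s s' M} → s ⟶α₁ˢ s' → s ∘ₜ M ⟶α₁ s' ∘ₜ M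
    closR : ∀ {s M M'} → M ⟶α₁ M' → s ∘ₜ M ⟶α₁ s ∘ₜ M'

  data _⟶α₁ˢ_ : Subst → Subst → Set where
    consL : ∀ {s s' N a} → s ⟶α₁ˢ s' → ⟨ s , N ∖ a ⟩ ⟶α₁ˢ ⟨ s' , N ∖ a ⟩
    consR : ∀ {s N N' a} → N ⟶α₁ N' → ⟨ s , N ∖ a ⟩ ⟶α₁ˢ ⟨ s , N' ∖ a ⟩
    compL : ∀ {s s' q} → s ⟶α₁ˢ s' → s ∘ₛ q ⟶α₁ˢ s' ∘ₛ q
    compR : ∀ {s q q'} → q ⟶α₁ˢ q' → s ∘ₛ q ⟶α₁ˢ s ∘ₛ q'

⇑ : Ctx → Subst → Subst
⇑ ε        s = s
⇑ (Σ' ▸ a) s = ⟨ π a ∘ₛ ⇑ Σ' s , var a ∖ a ⟩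

data _⊢_⇝α₂_⊢_ : Ctx → Term → Ctx → Term → Set where
  α₂ : ∀ {Γ Δ a b M} →
       a ∈⋃FVj ((ε ▸ a) ⧺ Δ) ⊢ M →
       ¬ (b ∈⋃FVj ((ε ▸ a) ⧺ Δ) ⊢ M) →
       ((Γ ▸ a) ⧺ Δ) ⊢ M ⇝α₂ ((Γ ▸ b) ⧺ Δ) ⊢ (⇑ Δ ⟨ π b , var b ∖ a ⟩ ∘ₜ M)

πs : Var → List Var → Subst
πs a₁ rest = foldl (λ s x → s ∘ₛ π x) (π a₁) rest

block : List Var → Var → Term
block []        b = π b ∘ₜ var b
block (a₁ ∷ as) b = πs a₁ (as ++ [ b ]) ∘ₜ var b

data BlockTerm : Term → Set where
  bvar   : ∀ {a} → BlockTerm (var a)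
  bblock : ∀ as b → BlockTerm (block as b)
  bapp   : ∀ {M N} → BlockTerm M → BlockTerm N → BlockTerm (M · N)
  blam   : ∀ {a M} → BlockTerm M → BlockTerm (lam a M)

data Pure : Term → Set where
  pvar : ∀ {a} → Pure (var a)
  papp : ∀ {M N} → Pure M → Pure N → Pure (M · N)
  plam : ∀ {a M} → Pure M → Pure (lam a M)

module Submission where

-- Call an occurrence of b in Γ ⊢ M *shadowed* if Γ = Γ₀,b,Δ and b lies in
-- FV_{k+2}(λΔ.M) for some k: it then does not refer to the displayed b, so
-- that b can be renamed.  A block (π_{a₁…a_m b}) ∘ b is exactly such an
-- occurrence of the variable m+1 places from the end of the context.
-- A shadowed occurrence in the whole judgement is exactly the side
-- condition of α₂, which gives the theorem.

open import Defs
open import Data.Nat using (ℕ; zero; suc; _+_; _⊔_; _<_; _≤_)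
open import Data.Nat.Properties
  using (m≤m⊔n; m≤n⊔m; m⊔n≤o⇒m≤o; m⊔n≤o⇒n≤o; <-≤-trans; n<1+n; <-irrefl)
open import Data.List using (List; []; _∷_; foldl; _++_; [_]; length)
open import Data.Product using (∃-syntax; _,_)
open import Data.Sum using (_⊎_; inj₁; inj₂; map₁; map₂)
open import Data.Empty using (⊥-elim)
open import Relation.Nullary using (¬_)
open import Relation.Binary.PropositionalEquality
  using (_≡_; refl; sym; cong; subst)

_⊆F_ : Family → Family → Set
A ⊆F B = ∀ i x → A i x → B i x

BoundedBy : Family → ℕ → Set
BoundedBy A n = ∀ i x → A i x → x < n

mutual
  bound : Term → ℕ
  bound (var a)   = suc a
  bound (M · N)   = bound M ⊔ bound N
  bound (lam a M) = bound M
  bound (s ∘ₜ M)  = bound M ⊔ boundS s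

  boundS : Subst → ℕ
  boundS idₛ           = 0
  boundS (π a)         = 0
  boundS ⟨ s , N ∖ a ⟩ = boundS s ⊔ bound N
  boundS (s ∘ₛ q)      = boundS s ⊔ boundS q

Oλ-bounded : ∀ a A n → BoundedBy A n → BoundedBy (Oλ a A) n
Oλ-bounded a A n h zero    x (inj₁ (p , _)) = h 0 x p
Oλ-bounded a A n h zero    x (inj₂ p)       = h 1 x p
Oλ-bounded a A n h (suc i) x p              = h (suc (suc i)) x p

mutual
  FV-bounded : ∀ M → BoundedBy (FV M) (bound M)
  FV-bounded (var a) zero x refl = n<1+n a
  FV-bounded (M · N) i x (inj₁ p) = <-≤-trans (FV-bounded M i x p) (m≤m⊔n _ _)
  FV-bounded (M · N) i x (inj₂ p) = <-≤-trans (FV-bounded N i x p) (m≤n⊔m _ _)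
  FV-bounded (lam a M) = Oλ-bounded a (FV M) (bound M) (FV-bounded M)
  FV-bounded (s ∘ₜ M) =
    O-bounded s (FV M) (bound M ⊔ boundS s)
      (λ j y q → <-≤-trans (FV-bounded M j y q) (m≤m⊔n _ _)) (m≤n⊔m _ _)

  O-bounded : ∀ s A n → BoundedBy A n → boundS s ≤ n → BoundedBy (O s A) n
  O-bounded idₛ A n h le = h
  O-bounded (π a) A n h le (suc i) x p = h i x p
  O-bounded ⟨ s , N ∖ a ⟩ A n h le i x (inj₁ p) =
    O-bounded s (Oλ a A) n (Oλ-bounded a A n h) (m⊔n≤o⇒m≤o _ _ le) i x p
  O-bounded ⟨ s , N ∖ a ⟩ A n h le i x (inj₂ p) =
    <-≤-trans (FV-bounded N i x p) (m⊔n≤o⇒n≤o _ _ le)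
  O-bounded (s ∘ₛ q) A n h le =
    O-bounded s (O q A) n (O-bounded q A n h (m⊔n≤o⇒n≤o _ _ le)) (m⊔n≤o⇒m≤o _ _ le)

fresh : ∀ M → ¬ (bound M ∈⋃FV M)
fresh M (i , p) = <-irrefl refl (FV-bounded M i (bound M) p)

Oλ-mono : ∀ c {A B} → A ⊆F B → Oλ c A ⊆F Oλ c B
Oλ-mono c h zero    x (inj₁ (p , q)) = inj₁ (h 0 x p , q)
Oλ-mono c h zero    x (inj₂ p)       = inj₂ (h 1 x p)
Oλ-mono c h (suc i) x p              = h (suc (suc i)) x p

lamCtx-mono : ∀ Δ {M N} → FV M ⊆F FV N → FV (lamCtx Δ M) ⊆F FV (lamCtx Δ N)
lamCtx-mono ε       h = h
lamCtx-mono (Δ ▸ c) h = lamCtx-mono Δ (Oλ-mono c h)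

lam-lowers : ∀ c N j x → FV N (suc j) x → FV (lam c N) j x
lam-lowers c N zero    x p = inj₂ p
lam-lowers c N (suc j) x p = p

lam-self : ∀ c N → FV (lam c N) 0 c → FV N 1 c
lam-self c N (inj₁ (_ , c≢c)) = ⊥-elim (c≢c refl)
lam-self c N (inj₂ p)         = p

lamCtx-⧺ : ∀ Γ Δ M → lamCtx (Γ ⧺ Δ) M ≡ lamCtx Γ (lamCtx Δ M)
lamCtx-⧺ Γ ε       M = refl
lamCtx-⧺ Γ (Δ ▸ a) M = lamCtx-⧺ Γ Δ (lam a M)

-- The context listing l from right to left (the order π-chains pop it).
rc : List Var → Ctx
rc []      = ε
rc (x ∷ l) = rc l ▸ x

rc-snoc : ∀ Σ' b l → (Σ' ⧺ rc (l ++ [ b ])) ≡ ((Σ' ▸ b) ⧺ rc l)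
rc-snoc Σ' b []      = refl
rc-snoc Σ' b (x ∷ l) = cong (_▸ x) (rc-snoc Σ' b l)

πChain : List Var → Subst
πChain []      = idₛ
πChain (c ∷ l) = πs c l

block-as-chain : ∀ as b → block as b ≡ πChain (as ++ [ b ]) ∘ₜ var b
block-as-chain []       b = refl
block-as-chain (a ∷ as) b = refl

foldl-π-typing : ∀ l s {Γ Σ'} →
  Γ ⊢ foldl (λ t x → t ∘ₛ π x) s l ▷ Σ' → Γ ⊢ s ▷ (Σ' ⧺ rc l)
foldl-π-typing []      s d = d
foldl-π-typing (x ∷ l) s d with foldl-π-typing l (s ∘ₛ π x) d
... | compR d' πR = d'

chain-typing : ∀ L {Γ Σ'} → Γ ⊢ πChain L ▷ Σ' → Γ ≡ (Σ' ⧺ rc L)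
chain-typing []      idR = refl
chain-typing (c ∷ l) d with foldl-π-typing l (π c) d
... | πR = refl

Oπⁿ : ℕ → Family → Family
Oπⁿ zero    A = A
Oπⁿ (suc n) A = Oπ (Oπⁿ n A)

Oπⁿ-shift : ∀ n A j x → A j x → Oπⁿ n A (n + j) x
Oπⁿ-shift zero    A j x p = p
Oπⁿ-shift (suc n) A j x p = Oπⁿ-shift n A j x p

O-foldl-π : ∀ l s A k x →
  O s (Oπⁿ (length l) A) k x → O (foldl (λ t y → t ∘ₛ π y) s l) A k x
O-foldl-π []      s A k x p = p
O-foldl-π (y ∷ l) s A k x p = O-foldl-π l (s ∘ₛ π y) A k x p

lamCtx-rc : ∀ l N k x → FV N (length l + k) x → FV (lamCtx (rc l) N) k x
lamCtx-rc []      N k x p = p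
lamCtx-rc (y ∷ l) N k x p = lamCtx-rc l (lam y N) k x (lam-lowers y N (length l + k) x p)

-- π_L raises every level by |L| and λ(rev L) lowers it back:
-- λ(rev L).(π_L ∘ N) keeps all free variables of N at their levels.
chain-transparent : ∀ L N j x → FV N j x → FV (lamCtx (rc L) (πChain L ∘ₜ N)) j x
chain-transparent []      N j x p = p
chain-transparent (c ∷ l) N j x p =
  lamCtx-rc (c ∷ l) (πs c l ∘ₜ N) j x
    (O-foldl-π l (π c) (FV N) (suc (length l + j)) x (Oπⁿ-shift (length l) (FV N) j x p))

-- Γ = Γ₀,b,Δ and b occurs in λΔ.M at a level ≥ 2: the occurrence does not
-- refer to the displayed b, so renaming that b is a genuine α-step.
record Shadowed (Γ : Ctx) (M : Term) : Set where
  constructor shadowed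
  field
    outer  : Ctx
    b      : Var
    inner  : Ctx
    split  : Γ ≡ ((outer ▸ b) ⧺ inner)
    level  : ℕ
    occurs : FV (lamCtx inner M) (suc level) b

shadowed-⊆ : ∀ {Γ M N} → FV M ⊆F FV N → Shadowed Γ M → Shadowed Γ N
shadowed-⊆ h (shadowed Γ₀ b Δ eq k p) =
  shadowed Γ₀ b Δ eq k (lamCtx-mono Δ h (suc k) b p)

lamCtx-rc-snoc : ∀ l b M → lamCtx (rc (l ++ [ b ])) M ≡ lam b (lamCtx (rc l) M)
lamCtx-rc-snoc []      b M = refl
lamCtx-rc-snoc (x ∷ l) b M = lamCtx-rc-snoc l b (lam x M)

-- Every derivable block has a shadowed occurrence: with L = a₁…a_m b,
-- Γ = Σ,b,(a_m…a₁) and b sits at level 1 of λ(a_m…a₁).block.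
block-shadowed : ∀ as b {Γ} → Γ ⊢ block as b → Shadowed Γ (block as b)
block-shadowed as b d with subst (_ ⊢_) (block-as-chain as b) d
... | clos {Δ = Σ'} d' _ =
  shadowed Σ' b (rc as) (subst (_ ≡_) (rc-snoc Σ' b as) (chain-typing L d')) 0
    (lam-self b (lamCtx (rc as) (block as b)) b-at-level-0)
  where
    L : List Var
    L = as ++ [ b ]

    b-at-level-0 : FV (lam b (lamCtx (rc as) (block as b))) 0 b
    b-at-level-0 =
      subst (λ T → FV T 0 b) (lamCtx-rc-snoc as b (block as b))
        (subst (λ T → FV (lamCtx (rc L) T) 0 b) (sym (block-as-chain as b))
          (chain-transparent L (var b) 0 b refl))

α₁-Reducible : Term → Set
α₁-Reducible M = ∃[ M' ] (M ⟶α₁ M')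

α₁-applies : ∀ a M → a ∈⋃FV lam a M → α₁-Reducible (lam a M)
α₁-applies a M occ = _ , α₁ occ (fresh (lam a M))

-- Under λa a shadowed occurrence either stays shadowed (it belongs to an
-- outer variable) or, if it is a itself, makes a occur in λa.M.
shadowed-lam : ∀ {Γ a M} → Shadowed (Γ ▸ a) M →
  a ∈⋃FV lam a M ⊎ Shadowed Γ (lam a M)
shadowed-lam {M = M} (shadowed Γ₀ b ε       refl k p) = inj₁ (k , lam-lowers b M k b p)
shadowed-lam         (shadowed Γ₀ b (Δ ▸ c) refl k p) = inj₂ (shadowed Γ₀ b Δ refl k p)

classify : ∀ {Γ M} → Γ ⊢ M → BlockTerm M →
  Pure M ⊎ (α₁-Reducible M ⊎ Shadowed Γ M)
classify d bvar = inj₁ pvar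
classify d (bblock as b) = inj₂ (inj₂ (block-shadowed as b d))
classify (app dM dN) (bapp bM bN) with classify dM bM | classify dN bN
... | inj₁ pM              | inj₁ pN              = inj₁ (papp pM pN)
... | inj₂ (inj₁ (_ , r)) | _                    = inj₂ (inj₁ (_ , appL r))
... | inj₂ (inj₂ sh)      | _                    = inj₂ (inj₂ (shadowed-⊆ (λ _ _ → inj₁) sh))
... | inj₁ _              | inj₂ (inj₁ (_ , r)) = inj₂ (inj₁ (_ , appR r))
... | inj₁ _              | inj₂ (inj₂ sh)      = inj₂ (inj₂ (shadowed-⊆ (λ _ _ → inj₂) sh))
classify (abs d) (blam {a} {M} bM) with classify d bM
... | inj₁ pM             = inj₁ (plam pM)
... | inj₂ (inj₁ (_ , r)) = inj₂ (inj₁ (_ , lamC r))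
... | inj₂ (inj₂ sh)      = inj₂ (map₁ (α₁-applies a M) (shadowed-lam sh))

-- A shadowed occurrence of b in Γ₀,b,Δ ⊢ M is the side condition of α₂:
-- b occurs in λb.λΔ.M, and renaming it to a fresh variable is an α₂-step.
α₂-applies : ∀ {Γ M} → Shadowed Γ M → ∃[ Γ' ] ∃[ M' ] (Γ ⊢ M ⇝α₂ Γ' ⊢ M')
α₂-applies {M = M} (shadowed Γ₀ b Δ refl k p) =
  _ , _ , α₂ {Γ₀} {Δ} {b} {bound T} {M} (k , b-occurs) (fresh T)
  where
    T : Term
    T = lamCtx ((ε ▸ b) ⧺ Δ) M

    b-occurs : FV T k b
    b-occurs = subst (λ U → FV U k b) (sym (lamCtx-⧺ (ε ▸ b) Δ M))
                 (lam-lowers b (lamCtx Δ M) k b p)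

mainTheorem7 : ∀ (Γ : Ctx) (M : Term) → Γ ⊢ M → BlockTerm M →
    Pure M ⊎ ((∃[ M' ] (M ⟶α₁ M')) ⊎ (∃[ Γ' ] ∃[ M' ] (Γ ⊢ M ⇝α₂ Γ' ⊢ M')))
mainTheorem7 Γ M d bM = map₂ (map₂ α₂-applies) (classify d bM)
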